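{- Every connected block graph and every connected cactus graph is great.
   Context: Graphs are finite and simple. A biconnected component of a connected graph is a maximal connected subgraph without a cut-vertex (a vertex whose removal disconnects it). A block graph is a graph in which every biconnected component is a clique; a cactus graph is a graph in which every biconnected component is a cycle. A connected ordering of the vertices of a connected graph is an ordering $v_1,\dots,v_n$ such that for every $i$ the subgraph induced by $v_1,\dots,v_i$ is connected. A connected graph $G$ is great if for every connected ordering $v_1,\dots,v_n$ of its vertices and every positive integer $i$, if $v_1$ is given colour $i$ and then $v_2,\dots,v_n$ are coloured in this order, each receiving the smallest positive integer not used by its already coloured neighbours, then all of $v_2,\dots,v_n$ receive colours in $\{1,\dots,\chi(G)\}$. -}

module Defs where

open import Data.Nat using (ℕ; zero; suc; _+_; _≤_; _<_; _%_)
open import Data.Fin using (Fin; toℕ)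
open import Data.Fin.Permutation using (Permutation′; _⟨$⟩ʳ_)
open import Data.Bool using (Bool; true; false)
open import Data.Product using (Σ; ∃; _×_; _,_)
open import Data.Sum using (_⊎_)
open import Relation.Nullary using (¬_)
open import Relation.Unary using (Pred; _∈_; _∉_; _⊆_; ∁)
open import Relation.Binary.PropositionalEquality using (_≡_; _≢_)
open import Function.Definitions using (Injective)
open import Level using (0ℓ)

record Graph (n : ℕ) : Set where
  field
    adj    : Fin n → Fin n → Bool
    sym    : ∀ u v → adj u v ≡ adj v u
    irrefl : ∀ v → adj v v ≡ false

open Graph public

VSet : ℕ → Set₁
VSet n = Pred (Fin n) 0ℓ

module _ {n : ℕ} (G : Graph n) where

  Adj : Fin n → Fin n → Set
  Adj u v = adj G u v ≡ true

  data Walk (S : VSet n) : Fin n → Fin n → Set where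
    here : ∀ {u} → u ∈ S → Walk S u u
    step : ∀ {u w v} → u ∈ S → Adj u w → Walk S w v → Walk S u v

  InducedConnected : VSet n → Set
  InducedConnected S = ∀ u v → u ∈ S → v ∈ S → Walk S u v

  Connected : Set
  Connected = InducedConnected (λ _ → Data.Unit.⊤)
    where import Data.Unit

  _─_ : VSet n → Fin n → VSet n
  (S ─ v) u = u ∈ S × u ≢ v

  IsCutVertex : VSet n → Fin n → Set
  IsCutVertex S v = v ∈ S × ¬ InducedConnected (S ─ v)

  Nonseparable : VSet n → Set
  Nonseparable S = InducedConnected S × (∀ v → ¬ IsCutVertex S v)

  -- S is (the vertex set of) a biconnected component: a maximal connected
  -- subgraph without a cut-vertex (maximal such subgraphs are induced)
  IsBlock : VSet n → Set₁
  IsBlock S = Nonseparable S × (∀ (T : VSet n) → S ⊆ T → Nonseparable T → T ⊆ S)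

  IsClique : VSet n → Set
  IsClique S = ∀ u v → u ∈ S → v ∈ S → u ≢ v → Adj u v

  -- the subgraph induced by S is a cycle C_k (k ≥ 3): an injective
  -- enumeration f : Fin k → Fin n of S with f i ~ f j iff i, j are
  -- consecutive modulo k
  -- j follows i cyclically in Fin k
  Consec : (k : ℕ) → Fin k → Fin k → Set
  Consec k i j = toℕ j ≡ suc (toℕ i) ⊎ (suc (toℕ i) ≡ k × toℕ j ≡ 0)

  IsCycle : VSet n → Set
  IsCycle S = Σ ℕ λ k → 3 ≤ k × Σ (Fin k → Fin n) λ f →
      Injective _≡_ _≡_ f
    × (∀ i → f i ∈ S)
    × (∀ v → v ∈ S → ∃ λ i → f i ≡ v)
    × (∀ i j → Adj (f i) (f j) →
          (Consec k i j ⊎ Consec k j i))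
    × (∀ i j → (Consec k i j ⊎ Consec k j i) →
          Adj (f i) (f j))

  BlockGraph : Set₁
  BlockGraph = ∀ S → IsBlock S → IsClique S

  CactusGraph : Set₁
  CactusGraph = ∀ S → IsBlock S → IsCycle S

  ProperColouring : ℕ → (Fin n → ℕ) → Set
  ProperColouring k c = (∀ v → 1 ≤ c v × c v ≤ k) × (∀ u v → Adj u v → c u ≢ c v)

  Colourable : ℕ → Set
  Colourable k = ∃ λ c → ProperColouring k c

  IsChromaticNumber : ℕ → Set
  IsChromaticNumber k = Colourable k × (∀ m → Colourable m → k ≤ m)

  -- a connected ordering v_1,…,v_n, given as a permutation σ with v_{t+1} = σ t
  Prefix : Permutation′ n → ℕ → VSet n
  Prefix σ t v = ∃ λ j → σ ⟨$⟩ʳ j ≡ v × toℕ j < t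

  IsConnectedOrdering : Permutation′ n → Set
  IsConnectedOrdering σ = ∀ t → t ≤ n → InducedConnected (Prefix σ t)

  -- c is the greedy (first-fit) colouring along σ with the first vertex
  -- coloured i: every later vertex gets the least positive integer not used
  -- by its already coloured neighbours
  IsGreedyColouring : Permutation′ n → ℕ → (Fin n → ℕ) → Set
  IsGreedyColouring σ i c =
      (∀ (z : Fin n) → toℕ z ≡ 0 → c (σ ⟨$⟩ʳ z) ≡ i)
    × (∀ (t : Fin n) → 0 < toℕ t →
          let v = σ ⟨$⟩ʳ t in
            1 ≤ c v
          × (∀ s → toℕ s < toℕ t → Adj (σ ⟨$⟩ʳ s) v → c (σ ⟨$⟩ʳ s) ≢ c v)
          × (∀ m → 1 ≤ m → m < c v →
               ∃ λ s → toℕ s < toℕ t × Adj (σ ⟨$⟩ʳ s) v × c (σ ⟨$⟩ʳ s) ≡ m))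

  Great : Set
  Great = ∀ σ → IsConnectedOrdering σ → ∀ i → 1 ≤ i → ∀ c → IsGreedyColouring σ i c →
          ∀ k → IsChromaticNumber k →
          ∀ (t : Fin n) → 0 < toℕ t → 1 ≤ c (σ ⟨$⟩ʳ t) × c (σ ⟨$⟩ʳ t) ≤ k

{-# OPTIONS --safe #-}
-- Let the t-th vertex v t receive colour m + 1 > 1. By greediness it has earlier neighbours of
-- colours 1, …, m, and any two earlier neighbours are joined by a path through earlier vertices,
-- which closes up to a cycle through v t; a cycle lies inside one block. In a block graph that
-- block is a clique, so v t and its earlier neighbours of colours 1, …, m form a clique and
-- m + 1 ≤ χ(G). In a cactus, if m ≥ 3, the cycles through the neighbours of colours 1, 2 and of
-- colours 1, 3 share two vertices and hence lie in a common block, a cycle in which v t would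
-- have three neighbours; so colours stay ≤ 3, which settles χ(G) ≥ 3. When χ(G) ≤ 2, the greedy
-- colouring along a connected ordering gives each later vertex colour 1 or 2 according to its
-- side of the bipartition.
-- Maximality is not decidable, so blocks are obtained only under double negation; this suffices
-- because what is drawn from a block (an adjacency, or ⊥) is decidable.

module Submission where

open import Defs
open import Data.Bool using (Bool; true; false; not)
open import Data.Bool.Properties using (not-injective; ¬-not)
import Data.Bool as Bool
open import Data.Empty using (⊥-elim)
open import Data.Fin as Fin using (Fin; toℕ; fromℕ<)
open import Data.Fin.Induction using (<-wellFounded)
open import Data.Fin.Permutation using (Permutation′; _⟨$⟩ʳ_; _⟨$⟩ˡ_; inverseˡ)
open import Data.Fin.Properties using (toℕ-injective; toℕ<n; toℕ-fromℕ<; pigeonhole; <⇒≢) renaming (_≟_ to _≟ᶠ_)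
open import Data.List using (List; []; _∷_; allFin)
open import Data.List.Membership.Propositional using () renaming (_∈_ to _∈ᴸ_; _∉_ to _∉ᴸ_)
open import Data.List.Membership.Propositional.Properties using (∈-allFin)
open import Data.List.Relation.Unary.All as All using (All; []; _∷_)
open import Data.List.Relation.Unary.Any using (here; there)
open import Data.Nat using (ℕ; suc; _≤_; _<_; z≤n; s≤s; _≤?_; _≟_; _≡ᵇ_)
open import Data.Nat.Properties using (<-irrefl; ≤-refl; >⇒≢; ≤-trans; ≤-<-trans; <⇒≤; ≤-pred; ≰⇒>; ≮⇒≥; ≤∧≢⇒<; ≤-antisym; suc-injective; ≡ᵇ⇒≡)
open import Data.Product using (Σ; ∃; _×_; _,_; proj₁; proj₂; map₁)
open import Data.Sum as Sum using (_⊎_; inj₁; inj₂; [_,_])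
open import Effect.Monad using (RawMonad)
open import Function using (_∘_)
open import Induction.WellFounded as WF using ()
open import Level using (0ℓ) renaming (suc to lsuc)
open import Relation.Nullary using (¬_; Dec; yes; no; contradiction)
open import Relation.Nullary.Decidable using (decidable-stable; ¬¬-excluded-middle)
open import Relation.Nullary.Negation using (¬¬-Monad; ¬¬-map)
open import Relation.Unary using (_⊆_; _∪_)
open import Relation.Binary.PropositionalEquality using (_≡_; _≢_; refl; trans; cong; subst) renaming (sym to ≡-sym)

first-of : ∀ {m} → Fin m → Fin m
first-of Fin.zero = Fin.zero
first-of (Fin.suc _) = Fin.zero

toℕ-first-of : ∀ {m} (j : Fin m) → toℕ (first-of j) ≡ 0
toℕ-first-of Fin.zero = refl
toℕ-first-of (Fin.suc _) = refl

≡ᵇ1-injective : ∀ {a b} → 1 ≤ a → a ≤ 2 → 1 ≤ b → b ≤ 2 → (a ≡ᵇ 1) ≡ (b ≡ᵇ 1) → a ≡ b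
≡ᵇ1-injective {1} {1} _ _ _ _ _ = refl
≡ᵇ1-injective {2} {2} _ _ _ _ _ = refl
≡ᵇ1-injective {1} {2} _ _ _ _ ()
≡ᵇ1-injective {2} {1} _ _ _ _ ()
≡ᵇ1-injective {suc (suc (suc _))} _ (s≤s (s≤s ())) _ _ _
≡ᵇ1-injective {_} {suc (suc (suc _))} _ _ _ (s≤s (s≤s ())) _

colour-of : Bool → ℕ
colour-of true = 1
colour-of false = 2

colour-of≡ᵇ1 : ∀ b → (colour-of b ≡ᵇ 1) ≡ b
colour-of≡ᵇ1 true = refl
colour-of≡ᵇ1 false = refl

colour-of≤2 : ∀ b → colour-of b ≤ 2
colour-of≤2 true = s≤s z≤n
colour-of≤2 false = s≤s (s≤s z≤n)

module _ {n : ℕ} (Q : VSet n → Set) where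

  Maximal : VSet n → Set₁
  Maximal T = Q T × (∀ U → T ⊆ U → Q U → U ⊆ T)

  private
    open RawMonad (¬¬-Monad {lsuc 0ℓ})

    MaximalAt : VSet n → Fin n → Set₁
    MaximalAt T x = ∀ U → T ⊆ U → Q U → U x → T x

    maximalAt-⊆ : ∀ {T T′ x} → T ⊆ T′ → MaximalAt T x → MaximalAt T′ x
    maximalAt-⊆ T⊆T′ max U T′⊆U QU Ux = T⊆T′ (max U (T′⊆U ∘ T⊆T′) QU Ux)

    -- Run through xs, replacing the current set by a Q-superset containing x whenever one exists.
    maximalAt-superset : ∀ xs {S} → Q S → ¬ ¬ (Σ (VSet n) λ T → Q T × S ⊆ T × All (MaximalAt T) xs)
    maximalAt-superset [] {S} QS none = none (S , QS , (λ Sx → Sx) , [])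
    maximalAt-superset (x ∷ xs) QS = do
      (T , QT , S⊆T , maxT) ← maximalAt-superset xs QS
      grow? ← ¬¬-excluded-middle {A = Σ (VSet n) λ U → T ⊆ U × Q U × U x}
      pure (adjoin T QT S⊆T maxT grow?)
      where
      adjoin : ∀ {S} T → Q T → S ⊆ T → All (MaximalAt T) xs →
               Dec (Σ (VSet n) λ U → T ⊆ U × Q U × U x) →
               Σ (VSet n) λ T → Q T × S ⊆ T × All (MaximalAt T) (x ∷ xs)
      adjoin T QT S⊆T maxT (yes (U , T⊆U , QU , Ux)) =
        U , QU , T⊆U ∘ S⊆T , (λ _ _ _ _ → Ux) ∷ All.map (maximalAt-⊆ T⊆U) maxT
      adjoin T QT S⊆T maxT (no ¬grow) =
        T , QT , S⊆T , (λ U T⊆U QU Ux → ⊥-elim (¬grow (U , T⊆U , QU , Ux))) ∷ maxT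

  maximal-superset : ∀ {S} → Q S → ¬ ¬ (Σ (VSet n) λ T → Maximal T × S ⊆ T)
  maximal-superset QS = ¬¬-map maximal (maximalAt-superset (allFin n) QS)
    where
    maximal : ∀ {S} → (Σ (VSet n) λ T → Q T × S ⊆ T × All (MaximalAt T) (allFin n)) →
              Σ (VSet n) λ T → Maximal T × S ⊆ T
    maximal (T , QT , S⊆T , maxT) = T , (QT , λ U T⊆U QU → All.lookup maxT (∈-allFin _) U T⊆U QU) , S⊆T

module GraphProperties {n : ℕ} (G : Graph n) where

  open import Data.List.Membership.DecPropositional (_≟ᶠ_ {n}) using () renaming (_∈?_ to _∈ᴸ?_)

  private
    variable
      S T : VSet n
      u v w x y : Fin n
      vs : List (Fin n)

  _∖_ : VSet n → Fin n → VSet n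
  _∖_ = _─_ G

  adj? : ∀ u v → Dec (Adj G u v)
  adj? u v = adj G u v Bool.≟ true

  adj-sym : Adj G u v → Adj G v u
  adj-sym {u} {v} uv = trans (Graph.sym G v u) uv

  adj⇒≢ : Adj G u v → u ≢ v
  adj⇒≢ {u} uv refl with () ← trans (≡-sym uv) (Graph.irrefl G u)

  walk-head : Walk G S u v → S u
  walk-head (here Su) = Su
  walk-head (step Su _ _) = Su

  walk-last : Walk G S u v → S v
  walk-last (here Sv) = Sv
  walk-last (step _ _ p) = walk-last p

  _++ʷ_ : Walk G S u v → Walk G S v w → Walk G S u w
  here _ ++ʷ q = q
  step Su uw p ++ʷ q = step Su uw (p ++ʷ q)

  walk-snoc : Walk G S u v → Adj G v w → S w → Walk G S u w
  walk-snoc p vw Sw = p ++ʷ step (walk-last p) vw (here Sw)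

  walk-reverse : Walk G S u v → Walk G S v u
  walk-reverse (here Su) = here Su
  walk-reverse (step Su uw p) = walk-snoc (walk-reverse p) (adj-sym uw) Su

  walk-⊆ : S ⊆ T → Walk G S u v → Walk G T u v
  walk-⊆ S⊆T (here Su) = here (S⊆T Su)
  walk-⊆ S⊆T (step Su uw p) = step (S⊆T Su) uw (walk-⊆ S⊆T p)

  connected-via : ∀ h → (∀ {x} → S x → Walk G S x h) → InducedConnected G S
  connected-via h to-h x y Sx Sy = to-h Sx ++ʷ walk-reverse (to-h Sy)

  data Path (S : VSet n) : Fin n → Fin n → List (Fin n) → Set where
    single : S u → Path S u u (u ∷ [])
    cons   : S u → Adj G u w → u ∉ᴸ vs → Path S w v vs → Path S u v (u ∷ vs)

  path-⊆ : Path S u v vs → x ∈ᴸ vs → S x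
  path-⊆ (single Su) (here refl) = Su
  path-⊆ (cons Su _ _ _) (here refl) = Su
  path-⊆ (cons _ _ _ p) (there x∈) = path-⊆ p x∈

  path-head : Path S u v vs → u ∈ᴸ vs
  path-head (single _) = here refl
  path-head (cons _ _ _ _) = here refl

  path-last : Path S u v vs → v ∈ᴸ vs
  path-last (single _) = here refl
  path-last (cons _ _ _ p) = there (path-last p)

  path-suffix : Path S u v vs → x ∈ᴸ vs → ∃ λ ws → Path S x v ws
  path-suffix p@(single _) (here refl) = _ , p
  path-suffix p@(cons _ _ _ _) (here refl) = _ , p
  path-suffix (cons _ _ _ p) (there x∈) = path-suffix p x∈

  walk⇒path : Walk G S u v → ∃ λ vs → Path S u v vs
  walk⇒path (here Su) = _ , single Su
  walk⇒path (step {u} Su uw p) with walk⇒path p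
  ... | vs , q with u ∈ᴸ? vs
  ...   | yes u∈ = path-suffix q u∈
  ...   | no u∉ = _ , cons Su uw u∉ q

  path-walk-to-last : Path S u v vs → x ∈ᴸ vs → Walk G (_∈ᴸ vs) x v
  path-walk-to-last (single _) (here refl) = here (here refl)
  path-walk-to-last (cons _ uw _ p) (here refl) =
    step (here refl) uw (walk-⊆ there (path-walk-to-last p (path-head p)))
  path-walk-to-last (cons _ _ _ p) (there x∈) = walk-⊆ there (path-walk-to-last p x∈)

  path-walk-avoiding : Path S u v vs → x ∈ᴸ vs → x ≢ y →
                       Walk G ((_∈ᴸ vs) ∖ y) x u ⊎ Walk G ((_∈ᴸ vs) ∖ y) x v
  path-walk-avoiding (single _) (here refl) x≢y = inj₁ (here (here refl , x≢y))
  path-walk-avoiding (cons _ _ _ _) (here refl) x≢y = inj₁ (here (here refl , x≢y))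
  path-walk-avoiding {y = y} (cons {u = u} _ uw u∉ p) (there x∈) x≢y with path-walk-avoiding p x∈ x≢y
  ... | inj₂ to-v = inj₂ (walk-⊆ (map₁ there) to-v)
  ... | inj₁ to-w with u ≟ᶠ y
  ...   | no u≢y = inj₁ (walk-snoc (walk-⊆ (map₁ there) to-w) (adj-sym uw) (here refl , u≢y))
  ...   | yes refl = inj₂ (walk-⊆ (λ z∈ → there z∈ , λ { refl → u∉ z∈ }) (path-walk-to-last p x∈))

  StronglyNonseparable : VSet n → Set
  StronglyNonseparable S = InducedConnected G S × (∀ y → InducedConnected G (S ∖ y))

  stronglyNonseparable⇒nonseparable : StronglyNonseparable S → Nonseparable G S
  stronglyNonseparable⇒nonseparable (conn , conn∖) = conn , λ y (_ , ¬conn∖y) → ¬conn∖y (conn∖ y)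

  stronglyNonseparable⊆block : StronglyNonseparable S → ¬ ¬ (Σ (VSet n) λ B → IsBlock G B × S ⊆ B)
  stronglyNonseparable⊆block = maximal-superset (Nonseparable G) ∘ stronglyNonseparable⇒nonseparable

  path-cycle-stronglyNonseparable : ¬ S v → Path S u w vs → Adj G u v → Adj G w v →
                                    StronglyNonseparable (λ x → x ≡ v ⊎ x ∈ᴸ vs)
  path-cycle-stronglyNonseparable {S} {v} {u} {w} {vs} ¬Sv p uv wv = connected-via v to-v , conn∖
    where
    C : VSet n
    C x = x ≡ v ⊎ x ∈ᴸ vs

    to-v : ∀ {x} → C x → Walk G C x v
    to-v (inj₁ refl) = here (inj₁ refl)
    to-v (inj₂ x∈) = walk-snoc (walk-⊆ inj₂ (path-walk-to-last p x∈)) wv (inj₁ refl)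

    v∉ : ∀ {x} → x ∈ᴸ vs → x ≢ v
    v∉ x∈ refl = ¬Sv (path-⊆ p x∈)

    conn∖ : ∀ y → InducedConnected G (C ∖ y)
    conn∖ y with v ≟ᶠ y
    ... | yes refl = connected-via w λ
      { (inj₁ refl , v≢v) → contradiction refl v≢v
      ; (inj₂ x∈ , _) → walk-⊆ (λ z∈ → inj₂ z∈ , v∉ z∈) (path-walk-to-last p x∈) }
    ... | no v≢y = connected-via v λ
      { (inj₁ refl , _) → here (inj₁ refl , v≢y)
      ; (inj₂ x∈ , x≢y) → [ (λ to-u → walk-snoc (walk-⊆ (map₁ inj₂) to-u) uv (inj₁ refl , v≢y))
                          , (λ to-w → walk-snoc (walk-⊆ (map₁ inj₂) to-w) wv (inj₁ refl , v≢y))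
                          ] (path-walk-avoiding p x∈ x≢y) }

  -- After deleting y, one of the two shared vertices survives and links both parts.
  ∪-stronglyNonseparable : StronglyNonseparable S → StronglyNonseparable T → u ≢ v →
                           S u → S v → T u → T v → StronglyNonseparable (S ∪ T)
  ∪-stronglyNonseparable {S} {T} {u} {v} (connS , connS∖) (connT , connT∖) u≢v Su Sv Tu Tv =
    connected-via u (λ { (inj₁ Sx) → walk-⊆ inj₁ (connS _ u Sx Su)
                       ; (inj₂ Tx) → walk-⊆ inj₂ (connT _ u Tx Tu) }) ,
    conn∖
    where
    via : ∀ y r → r ≢ y → S r → T r → InducedConnected G ((S ∪ T) ∖ y)
    via y r r≢y Sr Tr = connected-via r λ
      { (inj₁ Sx , x≢y) → walk-⊆ (map₁ inj₁) (connS∖ y _ r (Sx , x≢y) (Sr , r≢y))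
      ; (inj₂ Tx , x≢y) → walk-⊆ (map₁ inj₂) (connT∖ y _ r (Tx , x≢y) (Tr , r≢y)) }

    conn∖ : ∀ y → InducedConnected G ((S ∪ T) ∖ y)
    conn∖ y with u ≟ᶠ y
    ... | yes refl = via y v (u≢v ∘ ≡-sym) Sv Tv
    ... | no u≢y = via y u u≢y Su Tu

  consec-next-unique : ∀ {K} {i j j′ : Fin K} → Consec G K i j → Consec G K i j′ → j ≡ j′
  consec-next-unique (inj₁ j≡) (inj₁ j′≡) = toℕ-injective (trans j≡ (≡-sym j′≡))
  consec-next-unique {j = j} (inj₁ j≡) (inj₂ (i+1≡K , _)) =
    ⊥-elim (<-irrefl (trans j≡ i+1≡K) (toℕ<n j))
  consec-next-unique {j′ = j′} (inj₂ (i+1≡K , _)) (inj₁ j′≡) =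
    ⊥-elim (<-irrefl (trans j′≡ i+1≡K) (toℕ<n j′))
  consec-next-unique (inj₂ (_ , j≡0)) (inj₂ (_ , j′≡0)) = toℕ-injective (trans j≡0 (≡-sym j′≡0))

  consec-prev-unique : ∀ {K} {i i′ j : Fin K} → Consec G K i j → Consec G K i′ j → i ≡ i′
  consec-prev-unique (inj₁ j≡) (inj₁ j≡′) = toℕ-injective (suc-injective (trans (≡-sym j≡) j≡′))
  consec-prev-unique (inj₁ j≡) (inj₂ (_ , j≡0)) with () ← trans (≡-sym j≡) j≡0
  consec-prev-unique (inj₂ (_ , j≡0)) (inj₁ j≡) with () ← trans (≡-sym j≡) j≡0
  consec-prev-unique (inj₂ (i+1≡K , _)) (inj₂ (i′+1≡K , _)) =
    toℕ-injective (suc-injective (trans i+1≡K (≡-sym i′+1≡K)))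

  CyclicallyAdjacent : ∀ K → Fin K → Fin K → Set
  CyclicallyAdjacent K i j = Consec G K i j ⊎ Consec G K j i

  three-cyclic-neighbours : ∀ {K} {i₁ i₂ i₃ j : Fin K} →
    CyclicallyAdjacent K i₁ j → CyclicallyAdjacent K i₂ j → CyclicallyAdjacent K i₃ j →
    i₁ ≡ i₂ ⊎ i₁ ≡ i₃ ⊎ i₂ ≡ i₃
  three-cyclic-neighbours (inj₁ p₁) (inj₁ p₂) _         = inj₁ (consec-prev-unique p₁ p₂)
  three-cyclic-neighbours (inj₂ n₁) (inj₂ n₂) _         = inj₁ (consec-next-unique n₁ n₂)
  three-cyclic-neighbours (inj₁ p₁) (inj₂ _)  (inj₁ p₃) = inj₂ (inj₁ (consec-prev-unique p₁ p₃))
  three-cyclic-neighbours (inj₂ n₁) (inj₁ _)  (inj₂ n₃) = inj₂ (inj₁ (consec-next-unique n₁ n₃))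
  three-cyclic-neighbours (inj₁ _)  (inj₂ n₂) (inj₂ n₃) = inj₂ (inj₂ (consec-next-unique n₂ n₃))
  three-cyclic-neighbours (inj₂ _)  (inj₁ p₂) (inj₁ p₃) = inj₂ (inj₂ (consec-prev-unique p₂ p₃))

  cycle-three-neighbours : ∀ {B a b c} → IsCycle G B → B x → B a → B b → B c →
                           Adj G a x → Adj G b x → Adj G c x → a ≡ b ⊎ a ≡ c ⊎ b ≡ c
  cycle-three-neighbours (K , _ , f , _ , _ , onto , adj⇒cyclic , _) Bx Ba Bb Bc ax bx cx
    with onto _ Bx | onto _ Ba | onto _ Bb | onto _ Bc
  ... | j , refl | ia , refl | ib , refl | ic , refl =
    Sum.map (cong f) (Sum.map (cong f) (cong f))
      (three-cyclic-neighbours (adj⇒cyclic ia j ax) (adj⇒cyclic ib j bx) (adj⇒cyclic ic j cx))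

  colour-index : ∀ {k x} → 1 ≤ x × x ≤ k → Fin k
  colour-index {x = suc x} (_ , x<k) = fromℕ< x<k

  colour-index-injective : ∀ {k x y} (rx : 1 ≤ x × x ≤ k) (ry : 1 ≤ y × y ≤ k) →
                           colour-index rx ≡ colour-index ry → x ≡ y
  colour-index-injective {x = suc x} {suc y} (_ , x<k) (_ , y<k) eq =
    cong suc (trans (≡-sym (toℕ-fromℕ< x<k)) (trans (cong toℕ eq) (toℕ-fromℕ< y<k)))

  clique≤colours : ∀ {m k} (h : Fin m → Fin n) → (∀ {a b} → a ≢ b → Adj G (h a) (h b)) →
                   Colourable G k → m ≤ k
  clique≤colours {m} {k} h clique (col , range , proper) with m ≤? k
  ... | yes m≤k = m≤k
  ... | no m≰k with pigeonhole (≰⇒> m≰k) (colour-index ∘ range ∘ h)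
  ...   | a , b , a<b , same =
    contradiction (colour-index-injective (range (h a)) (range (h b)) same) (proper _ _ (clique (<⇒≢ a<b)))

  edge⇒2≤colours : ∀ {k} → Adj G u v → Colourable G k → 2 ≤ k
  edge⇒2≤colours {u} {v} uv = clique≤colours h clique
    where
    h : Fin 2 → Fin n
    h Fin.zero = u
    h (Fin.suc _) = v
    clique : ∀ {a b} → a ≢ b → Adj G (h a) (h b)
    clique {Fin.zero} {Fin.zero} a≢b = contradiction refl a≢b
    clique {Fin.zero} {Fin.suc Fin.zero} _ = uv
    clique {Fin.suc Fin.zero} {Fin.zero} _ = adj-sym uv
    clique {Fin.suc Fin.zero} {Fin.suc Fin.zero} a≢b = contradiction refl a≢b

module GreedyColouring {n : ℕ} (G : Graph n) (σ : Permutation′ n) (ordered : IsConnectedOrdering G σ)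
                       (i : ℕ) (c : Fin n → ℕ) (greedy : IsGreedyColouring G σ i c) where

  open GraphProperties G

  private
    variable
      s s₁ s₂ t : Fin n

  v : Fin n → Fin n
  v = σ ⟨$⟩ʳ_

  v-injective : v s ≡ v t → s ≡ t
  v-injective eq = trans (≡-sym (inverseˡ σ)) (trans (cong (σ ⟨$⟩ˡ_) eq) (inverseˡ σ))

  EarlierNeighbour : Fin n → Fin n → Set
  EarlierNeighbour s t = s Fin.< t × Adj G (v s) (v t)

  colour-first : toℕ s ≡ 0 → c (v s) ≡ i
  colour-first = proj₁ greedy _

  colour-positive : 0 < toℕ t → 1 ≤ c (v t)
  colour-positive t>0 = proj₁ (proj₂ greedy _ t>0)

  colour-proper : 0 < toℕ t → EarlierNeighbour s t → c (v s) ≢ c (v t)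
  colour-proper t>0 (s<t , st) = proj₁ (proj₂ (proj₂ greedy _ t>0)) _ s<t st

  colour-least : 0 < toℕ t → ∀ {m} → 1 ≤ m → m < c (v t) →
                 ∃ λ s → EarlierNeighbour s t × c (v s) ≡ m
  colour-least t>0 {m} 1≤m m<c with proj₂ (proj₂ (proj₂ greedy _ t>0)) m 1≤m m<c
  ... | s , s<t , st , cs = s , (s<t , st) , cs

  ≢-colour⇒≢ : ∀ {a b x y} → c (v a) ≡ x → c (v b) ≡ y → x ≢ y → v a ≢ v b
  ≢-colour⇒≢ ca cb x≢y va≡vb = x≢y (trans (≡-sym ca) (trans (cong c va≡vb) cb))

  v∉prefix : ¬ Prefix G σ (toℕ t) (v t)
  v∉prefix (s , vs≡vt , s<t) = <⇒≢ s<t (v-injective vs≡vt)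

  earlier-neighbour : 0 < toℕ t → ∃ λ s → EarlierNeighbour s t
  earlier-neighbour {t} t>0 =
    first-step (ordered (suc (toℕ t)) (toℕ<n t) (v t) (v z) (t , refl , s≤s ≤-refl) (z , refl , s≤s z≤t))
               refl
    where
    z : Fin n
    z = first-of t

    z≤t : toℕ z ≤ toℕ t
    z≤t = subst (_≤ toℕ t) (≡-sym (toℕ-first-of t)) z≤n

    first-step : ∀ {w} → Walk G (Prefix G σ (suc (toℕ t))) (v t) w → w ≡ v z →
                 ∃ λ s → EarlierNeighbour s t
    first-step (here _) vt≡vz =
      contradiction (trans (cong toℕ (v-injective vt≡vz)) (toℕ-first-of t)) (>⇒≢ t>0)
    first-step (step _ vt~x p) _ with walk-head p
    ... | s , refl , s<t+1 =
      s , ≤∧≢⇒< (≤-pred s<t+1) (λ s≡t → adj⇒≢ vt~x (cong v (≡-sym (toℕ-injective s≡t)))) ,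
      adj-sym vt~x

  earlier-neighbours-cycle : EarlierNeighbour s₁ t → EarlierNeighbour s₂ t →
    Σ (VSet n) λ C → StronglyNonseparable C × C (v t) × C (v s₁) × C (v s₂)
  earlier-neighbours-cycle {s₁} {t} {s₂} (s₁<t , e₁) (s₂<t , e₂)
    with walk⇒path (ordered (toℕ t) (<⇒≤ (toℕ<n t)) (v s₁) (v s₂)
                            (s₁ , refl , s₁<t) (s₂ , refl , s₂<t))
  ... | _ , p = _ , path-cycle-stronglyNonseparable (v∉prefix {t}) p e₁ e₂ ,
                inj₁ refl , inj₂ (path-head p) , inj₂ (path-last p)

  earlier-neighbours-adjacent : BlockGraph G → EarlierNeighbour s₁ t → EarlierNeighbour s₂ t →
                                v s₁ ≢ v s₂ → Adj G (v s₁) (v s₂)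
  earlier-neighbours-adjacent blocks e₁ e₂ vs₁≢vs₂ with earlier-neighbours-cycle e₁ e₂
  ... | C , sns , _ , C₁ , C₂ = decidable-stable (adj? _ _) λ ¬adj →
    stronglyNonseparable⊆block sns λ (B , isBlock , C⊆B) →
      ¬adj (blocks B isBlock _ _ (C⊆B C₁) (C⊆B C₂) vs₁≢vs₂)

  block-graph-colour≤ : BlockGraph G → ∀ {k} → Colourable G k → 0 < toℕ t → c (v t) ≤ k
  block-graph-colour≤ {t} blocks col t>0 with c (v t) in ct≡ | colour-positive t>0
  ... | suc m | _ = clique≤colours h clique col
    where
    coloured : (j : Fin m) → ∃ λ s → EarlierNeighbour s t × c (v s) ≡ suc (toℕ j)
    coloured j = colour-least t>0 (s≤s z≤n) (subst (suc (toℕ j) <_) (≡-sym ct≡) (s≤s (toℕ<n j)))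

    h : Fin (suc m) → Fin n
    h Fin.zero = v t
    h (Fin.suc j) = v (proj₁ (coloured j))

    clique : ∀ {a b} → a ≢ b → Adj G (h a) (h b)
    clique {Fin.zero} {Fin.zero} a≢b = contradiction refl a≢b
    clique {Fin.zero} {Fin.suc j} _ = adj-sym (proj₂ (proj₁ (proj₂ (coloured j))))
    clique {Fin.suc j} {Fin.zero} _ = proj₂ (proj₁ (proj₂ (coloured j)))
    clique {Fin.suc j} {Fin.suc l} j≢l =
      earlier-neighbours-adjacent blocks (proj₁ (proj₂ (coloured j))) (proj₁ (proj₂ (coloured l)))
        (≢-colour⇒≢ (proj₂ (proj₂ (coloured j))) (proj₂ (proj₂ (coloured l)))
          (j≢l ∘ cong Fin.suc ∘ toℕ-injective ∘ suc-injective))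

  cactus-colour≤3 : CactusGraph G → 0 < toℕ t → c (v t) ≤ 3
  cactus-colour≤3 {t} cactus t>0 = ≮⇒≥ no-fourth-colour
    where
    no-fourth-colour : ¬ 3 < c (v t)
    no-fourth-colour 3<c
      with colour-least t>0 {1} (s≤s z≤n) (≤-<-trans (s≤s z≤n) 3<c)
         | colour-least t>0 {2} (s≤s z≤n) (≤-<-trans (s≤s (s≤s z≤n)) 3<c)
         | colour-least t>0 {3} (s≤s z≤n) 3<c
    ... | s₁ , e₁ , c₁ | s₂ , e₂ , c₂ | s₃ , e₃ , c₃
      with earlier-neighbours-cycle e₁ e₂ | earlier-neighbours-cycle e₁ e₃
    ... | C , snsC , Ct , C₁ , C₂ | D , snsD , Dt , D₁ , D₃ =
      stronglyNonseparable⊆block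
        (∪-stronglyNonseparable snsC snsD (adj⇒≢ (proj₂ e₁) ∘ ≡-sym) Ct C₁ Dt D₁)
        λ (B , isBlock , C∪D⊆B) →
          [ ≢-colour⇒≢ c₁ c₂ (λ ()) , [ ≢-colour⇒≢ c₁ c₃ (λ ()) , ≢-colour⇒≢ c₂ c₃ (λ ()) ] ]
            (cycle-three-neighbours (cactus B isBlock)
              (C∪D⊆B (inj₁ Ct)) (C∪D⊆B (inj₁ C₁)) (C∪D⊆B (inj₁ C₂)) (C∪D⊆B (inj₂ D₃))
              (proj₂ e₁) (proj₂ e₂) (proj₂ e₃))

  colour≡1 : 0 < toℕ t → (∀ {s} → EarlierNeighbour s t → c (v s) ≢ 1) → c (v t) ≡ 1
  colour≡1 t>0 none-1 = ≤-antisym (≮⇒≥ no-1) (colour-positive t>0)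
    where
    no-1 : ¬ 1 < c (v _)
    no-1 1<c with colour-least t>0 ≤-refl 1<c
    ... | _ , e , cs≡1 = none-1 e cs≡1

  colour≡2 : 0 < toℕ t → (∀ {s} → EarlierNeighbour s t → c (v s) ≡ 1) → c (v t) ≡ 2
  colour≡2 t>0 all-1 = ≤-antisym (≮⇒≥ no-2) (≤∧≢⇒< (colour-positive t>0) not-1)
    where
    no-2 : ¬ 2 < c (v _)
    no-2 2<c with colour-least t>0 (s≤s z≤n) 2<c
    ... | _ , e , cs≡2 with () ← trans (≡-sym (all-1 e)) cs≡2

    not-1 : 1 ≢ c (v _)
    not-1 1≡c with earlier-neighbour t>0
    ... | _ , e = colour-proper t>0 e (trans (all-1 e) 1≡c)

  module ByParity (parity : Fin n → Bool) (flips : ∀ {x y} → Adj G x y → parity x ≢ parity y)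
                  (first : ∀ {s} → toℕ s ≡ 0 → (i ≡ᵇ 1) ≡ parity (v s)) where

    Agrees : Fin n → Set
    Agrees s = (c (v s) ≡ᵇ 1) ≡ parity (v s)

    colour≡1⇒parity : Agrees s → c (v s) ≡ 1 → true ≡ parity (v s)
    colour≡1⇒parity {s} agrees cs≡1 = subst (λ x → (x ≡ᵇ 1) ≡ parity (v s)) cs≡1 agrees

    parity⇒colour≡1 : Agrees s → parity (v s) ≡ true → c (v s) ≡ 1
    parity⇒colour≡1 agrees ps = ≡ᵇ⇒≡ _ 1 (subst Bool.T (≡-sym (trans agrees ps)) _)

    colour-by-parity : 0 < toℕ t → (∀ {s} → EarlierNeighbour s t → Agrees s) →
                       c (v t) ≡ colour-of (parity (v t))
    colour-by-parity {t} t>0 agree with parity (v t) in pt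
    ... | true = colour≡1 t>0 λ e cs≡1 →
      flips (proj₂ e) (trans (≡-sym (colour≡1⇒parity (agree e) cs≡1)) (≡-sym pt))
    ... | false = colour≡2 t>0 λ e →
      parity⇒colour≡1 (agree e) (trans (¬-not (flips (proj₂ e))) (cong not pt))

    agrees : ∀ t → Agrees t
    agrees = WF.All.wfRec <-wellFounded 0ℓ Agrees agrees-from-earlier
      where
      agrees-from-earlier : ∀ t → (∀ {s} → s Fin.< t → Agrees s) → Agrees t
      agrees-from-earlier t earlier with toℕ t ≟ 0
      ... | yes t≡0 = subst (λ x → (x ≡ᵇ 1) ≡ parity (v t)) (≡-sym (colour-first t≡0)) (first t≡0)
      ... | no t≢0 = trans (cong (_≡ᵇ 1) (colour-by-parity t>0 (earlier ∘ proj₁))) (colour-of≡ᵇ1 _)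
        where
        t>0 : 0 < toℕ t
        t>0 = ≤∧≢⇒< z≤n (t≢0 ∘ ≡-sym)

    colour≤2 : 0 < toℕ t → c (v t) ≤ 2
    colour≤2 t>0 = subst (_≤ 2) (≡-sym (colour-by-parity t>0 λ _ → agrees _)) (colour-of≤2 _)

  two-colourable-colour≤2 : ∀ {k} → Colourable G k → k ≤ 2 → 0 < toℕ t → c (v t) ≤ 2
  two-colourable-colour≤2 {t} {k} (col , range , proper) k≤2 t>0 =
    by-first ((i ≡ᵇ 1) Bool.≟ side (v z))
    where
    side : Fin n → Bool
    side x = col x ≡ᵇ 1

    side-flips : ∀ {x y} → Adj G x y → side x ≢ side y
    side-flips {x} {y} xy same = proper x y xy
      (≡ᵇ1-injective (proj₁ (range x)) (≤-trans (proj₂ (range x)) k≤2)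
                     (proj₁ (range y)) (≤-trans (proj₂ (range y)) k≤2) same)

    z : Fin n
    z = first-of t

    is-first : ∀ {s} → toℕ s ≡ 0 → z ≡ s
    is-first s≡0 = toℕ-injective (trans (toℕ-first-of t) (≡-sym s≡0))

    -- The first vertex must have parity true exactly when i = 1: take the side or its negation.
    by-first : Dec ((i ≡ᵇ 1) ≡ side (v z)) → c (v t) ≤ 2
    by-first (yes agree) =
      ByParity.colour≤2 side side-flips (λ s≡0 → trans agree (cong (side ∘ v) (is-first s≡0))) t>0
    by-first (no disagree) =
      ByParity.colour≤2 (not ∘ side) (λ xy → side-flips xy ∘ not-injective)
        (λ s≡0 → trans (¬-not disagree) (cong (not ∘ side ∘ v) (is-first s≡0))) t>0

-- Only the k-colourability half of χ(G) = k is used.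
corollary2 : ∀ (n : ℕ) (G : Graph n) → Connected G → (BlockGraph G ⊎ CactusGraph G) → Great G
corollary2 n G _ blocks-or-cycles σ ordered i _ c greedy k (colourable , _) t t>0 =
  colour-positive t>0 , colour≤k blocks-or-cycles
  where
  open GraphProperties G using (edge⇒2≤colours)
  open GreedyColouring G σ ordered i c greedy

  colour≤k : BlockGraph G ⊎ CactusGraph G → c (v t) ≤ k
  colour≤k (inj₁ blocks) = block-graph-colour≤ blocks colourable t>0
  colour≤k (inj₂ cactus) with 3 ≤? k
  ... | yes 3≤k = ≤-trans (cactus-colour≤3 cactus t>0) 3≤k
  ... | no 3≰k = ≤-trans (two-colourable-colour≤2 colourable k≤2 t>0)
                         (edge⇒2≤colours (proj₂ (proj₂ (earlier-neighbour t>0))) colourable)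
    where
    k≤2 : k ≤ 2
    k≤2 = ≤-pred (≰⇒> 3≰k)
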